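{- Let $k\ge 2$, $h=3k$, and let $W\in\mathcal W^2_{h\times 6}$ with $e(W)=2$ be such that, for every $h'<h$, every sub-word $W'$ of $W$ formed by $h'$ consecutive rows satisfies $e(W')\le \hat e_{max}(h',6)$. Then $|W[1]|_\blacksquare=5$, $|W[2]|_\blacksquare=4$ and $|W[3]|_\blacksquare=4$.
   Context: A 2-dimensional binary word of dimensions $h\times w$ is an $h\times w$ matrix $W$ with entries in $\{\square,\blacksquare\}$ (filled cells $\blacksquare$, empty cells $\square$); $|V|_\blacksquare$ is the number of filled cells of a word $V$. Positions $(i,j),(i',j')$ are adjacent if $|i-i'|+|j-j'|=1$; the degree of a filled cell is the number of filled cells adjacent to it. $\mathcal W^2_{h\times w}$ is the set of $h\times w$ words in which every filled cell has degree at most $2$. $W[i]$ denotes the $i$-th row of $W$. The excess of an $a\times b$ word $V$ is $e(V)=|V|_\blacksquare-2ab/3$ (computed with the dimensions of $V$ itself). For positive integers $a\ge b$, $\hat e_{max}(a,b)$ equals $ab/3$ if $b=1$ or $a=b=2$; $ab/12$ if $a$ is even, $a\ge4$, $b=2$; $ab/12+1/2$ if $a$ is odd, $a\ge 3$, $b=2$; $2$ if $b=3$ or $a\equiv b\equiv 0\pmod 3$; $4/3$ if $b\ge 4$ and $a\equiv b\not\equiv 0\pmod 3$; $1$ if $b\ge4$, $ab\equiv 0 \pmod 3$ and $a\not\equiv b\pmod 3$; and $2/3$ otherwise. For $a<b$, $\hat e_{max}(a,b)=\hat e_{max}(b,a)$. -}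

module Defs where

open import Data.Bool using (Bool; true; false; if_then_else_; _∧_; _∨_; not)
open import Data.Nat using (ℕ; zero; suc; _+_; _*_; _≤_; _<_; _≡ᵇ_; _≤ᵇ_; _%_; ∣_-_∣)
open import Data.Fin using (Fin; toℕ; inject≤; _↑ʳ_)
open import Data.List using (List; map; allFin)
open import Data.Nat.ListAction using (sum)
open import Data.Integer using (ℤ; +_)
open import Data.Rational using (ℚ; _/_)
  renaming (_+_ to _+ℚ_; _-_ to _-ℚ_; _≤_ to _≤ℚ_)

-- A 2-dimensional binary word of dimensions h × w; true = filled cell (■), false = empty (□).
Word : ℕ → ℕ → Set
Word h w = Fin h → Fin w → Bool

Σ-Fin : (n : ℕ) → (Fin n → ℕ) → ℕ
Σ-Fin n f = sum (map f (allFin n))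

toN : Bool → ℕ
toN true  = 1
toN false = 0

filled : {h w : ℕ} → Word h w → ℕ
filled {h} {w} V = Σ-Fin h λ i → Σ-Fin w λ j → toN (V i j)

adjacent : {h w : ℕ} → Fin h → Fin w → Fin h → Fin w → Bool
adjacent i j i' j' = (∣ toℕ i - toℕ i' ∣ Data.Nat.+ ∣ toℕ j - toℕ j' ∣) ≡ᵇ 1

degree : {h w : ℕ} → Word h w → Fin h → Fin w → ℕ
degree {h} {w} V i j =
  Σ-Fin h λ i' → Σ-Fin w λ j' → toN (adjacent i j i' j' ∧ V i' j')

InW2 : {h w : ℕ} → Word h w → Set
InW2 {h} {w} V = (i : Fin h) (j : Fin w) → V i j ≡ true → degree V i j Data.Nat.≤ 2
  where open import Relation.Binary.PropositionalEquality using (_≡_)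

-- number of filled cells in row r of W (rows indexed 1..h, as in the paper: W[r])
rowFilled : {h w : ℕ} → Word h w → ℕ → ℕ
rowFilled {h} {w} V r =
  Σ-Fin h λ i → if (suc (toℕ i) ≡ᵇ r) then (Σ-Fin w λ j → toN (V i j)) else 0

rowsFrom : {h w : ℕ} → Word h w → (s h' : ℕ) → s Data.Nat.+ h' Data.Nat.≤ h → Word h' w
rowsFrom V s h' le i j = V (inject≤ (s ↑ʳ i) le) j

excess : {a b : ℕ} → Word a b → ℚ
excess {a} {b} V = ((+ filled V) / 1) -ℚ ((+ (2 Data.Nat.* a Data.Nat.* b)) / 3)

-- ê_max(a,b) for a ≥ b (cases checked in the order given in the paper)
emaxGE : ℕ → ℕ → ℚ
emaxGE a b =
  if (b ≡ᵇ 1) ∨ ((a ≡ᵇ 2) ∧ (b ≡ᵇ 2)) then (+ (a Data.Nat.* b)) / 3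
  else if (b ≡ᵇ 2) ∧ (a % 2 ≡ᵇ 0) ∧ (4 ≤ᵇ a) then (+ (a Data.Nat.* b)) / 12
  else if (b ≡ᵇ 2) ∧ (a % 2 ≡ᵇ 1) ∧ (3 ≤ᵇ a) then ((+ (a Data.Nat.* b)) / 12) +ℚ ((+ 1) / 2)
  else if (b ≡ᵇ 3) ∨ ((a % 3 ≡ᵇ 0) ∧ (b % 3 ≡ᵇ 0)) then (+ 2) / 1
  else if (4 ≤ᵇ b) ∧ (a % 3 ≡ᵇ b % 3) ∧ not (b % 3 ≡ᵇ 0) then (+ 4) / 3
  else if (4 ≤ᵇ b) ∧ ((a Data.Nat.* b) % 3 ≡ᵇ 0) ∧ not (a % 3 ≡ᵇ b % 3) then (+ 1) / 1
  else (+ 2) / 3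

emax : ℕ → ℕ → ℚ
emax a b = if b ≤ᵇ a then emaxGE a b else emaxGE b a

{-# OPTIONS --safe #-}
module Submission where

-- Since e(W) = 2, W has 4h + 2 filled cells, whereas a block of h′ < h consecutive rows has at
-- most 4h′ + ê_max(h′, 6) ≤ 4h′ + 2. Comparing the top j ≤ 5 rows with the complementary block
-- bounds |W[1]| + ⋯ + |W[j]| from below, and blocks of 2 and 4 rows bound such sums from above.
-- The degree condition adds a local constraint: a row with 6 (resp. 5) filled cells leaves room
-- for at most 2 (resp. 6) filled cells in its two neighbouring rows, as a check of all 64 rows
-- of width 6 shows. These linear constraints force the counts 5, 4, 4; for h = 6 the complement
-- of the top five rows is a single row with ê_max(1, 6) = 2, and the full last row W[6] is used.

open import Defs
open import Data.Bool using (Bool; true; false; if_then_else_; _∧_; T)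
open import Data.Bool.Properties using (T-∧; T-≡; ∧-zeroʳ)
open import Data.Empty using (⊥)
open import Data.Fin using (Fin; zero; suc; toℕ; fromℕ<; inject≤; _↑ʳ_)
open import Data.Fin.Properties
  using (toℕ-fromℕ<; fromℕ<-toℕ; toℕ<n; toℕ-inject≤; toℕ-↑ʳ; toℕ-injective)
  renaming (suc-injective to Fin-suc-injective)
open import Data.Integer as ℤ using (+_)
import Data.Integer.Properties as ℤᴾ
import Data.Integer.Tactic.RingSolver as ℤ-Solver
open import Data.List using (map; allFin)
open import Data.List.Properties using (map-cong; map-tabulate)
open import Data.Nat hiding (_/_)
open import Data.Nat.ListAction using (sum)
open import Data.Nat.Properties
open import Algebra.Properties.CommutativeSemigroup +-commutativeSemigroup using (interchange; xy∙z≈xz∙y)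
open import Data.Nat.Tactic.RingSolver using (solve-∀)
open import Data.Product using (_×_; _,_; proj₁; proj₂)
open import Data.Rational using (_/_; toℚᵘ) renaming (_≤_ to _≤ℚ_; _-_ to _-ℚ_; -_ to -ℚ_)
import Data.Rational.Properties as ℚᴾ
open import Data.Rational.Unnormalised as ℚᵘ using (mkℚᵘ; *≤*)
import Data.Rational.Unnormalised.Properties as ℚᵘᴾ
open import Data.Vec using (Vec; []; _∷_; lookup; tabulate)
open import Function using (_∘_; id; Equivalence)
open import Relation.Binary.PropositionalEquality
open import Relation.Nullary using (yes; no; contradiction)

open ≤-Reasoning

Σ-Fin-suc : ∀ {n} (f : Fin (suc n) → ℕ) → Σ-Fin (suc n) f ≡ f zero + Σ-Fin n (f ∘ suc)
Σ-Fin-suc f =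
  cong (λ xs → f zero + sum xs) (trans (map-tabulate suc f) (sym (map-tabulate id (f ∘ suc))))

Σ-Fin-cong : ∀ {n} {f g : Fin n → ℕ} → f ≗ g → Σ-Fin n f ≡ Σ-Fin n g
Σ-Fin-cong {n} f≗g = cong sum (map-cong f≗g (allFin n))

Σ-Fin-zero : ∀ {n} {f : Fin n → ℕ} → (∀ i → f i ≡ 0) → Σ-Fin n f ≡ 0
Σ-Fin-zero {zero}  _   = refl
Σ-Fin-zero {suc n} {f} f≡0 = trans (Σ-Fin-suc f) (cong₂ _+_ (f≡0 zero) (Σ-Fin-zero (f≡0 ∘ suc)))

Σ-Fin-single : ∀ {n} (f : Fin n → ℕ) (i : Fin n) → (∀ j → j ≢ i → f j ≡ 0) → Σ-Fin n f ≡ f i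
Σ-Fin-single f zero off =
  trans (Σ-Fin-suc f)
        (trans (cong (λ x → f zero + x) (Σ-Fin-zero λ j → off (suc j) λ ())) (+-identityʳ _))
Σ-Fin-single f (suc i) off =
  trans (Σ-Fin-suc f)
        (cong₂ _+_ (off zero λ ())
                   (Σ-Fin-single (f ∘ suc) i λ j j≢i → off (suc j) (j≢i ∘ Fin-suc-injective)))

Σ-Fin-mono : ∀ {n} {f g : Fin n → ℕ} → (∀ i → f i ≤ g i) → Σ-Fin n f ≤ Σ-Fin n g
Σ-Fin-mono {zero}  _ = z≤n
Σ-Fin-mono {suc n} {f} {g} f≤g rewrite Σ-Fin-suc f | Σ-Fin-suc g =
  +-mono-≤ (f≤g zero) (Σ-Fin-mono (f≤g ∘ suc))

Σ-Fin-+ : ∀ {n} (f g : Fin n → ℕ) → Σ-Fin n f + Σ-Fin n g ≡ Σ-Fin n (λ i → f i + g i)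
Σ-Fin-+ {zero}  f g = refl
Σ-Fin-+ {suc n} f g rewrite Σ-Fin-suc f | Σ-Fin-suc g | Σ-Fin-suc (λ i → f i + g i) =
  trans (interchange (f zero) _ (g zero) _)
        (cong (λ x → f zero + g zero + x) (Σ-Fin-+ (f ∘ suc) (g ∘ suc)))

-- sumFrom g s h = g s + g (1 + s) + ⋯ + g (h - 1 + s), accumulated from the left and indexed
-- as h + s so that sums of a fixed length unfold definitionally, even for a variable start s.
sumFrom : (ℕ → ℕ) → ℕ → ℕ → ℕ
sumFrom g s zero    = 0
sumFrom g s (suc h) = sumFrom g s h + g (h + s)

sumFrom-+ : ∀ g s a b → sumFrom g s (a + b) ≡ sumFrom g s a + sumFrom g (s + a) b
sumFrom-+ g s a zero = trans (cong (sumFrom g s) (+-identityʳ a)) (sym (+-identityʳ _))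
sumFrom-+ g s a (suc b) = begin-equality
  sumFrom g s (a + suc b)                                ≡⟨ cong (sumFrom g s) (+-suc a b) ⟩
  sumFrom g s (a + b) + g (a + b + s)                    ≡⟨ cong₂ _+_ (sumFrom-+ g s a b) (cong g (index a b s)) ⟩
  sumFrom g s a + sumFrom g (s + a) b + g (b + (s + a))  ≡⟨ +-assoc (sumFrom g s a) _ _ ⟩
  sumFrom g s a + sumFrom g (s + a) (suc b)              ∎
  where
  index : ∀ a b s → a + b + s ≡ b + (s + a)
  index = solve-∀

sumFrom-suc : ∀ g s h → sumFrom g s (suc h) ≡ g s + sumFrom g (suc s) h
sumFrom-suc g s h = trans (sumFrom-+ g s 1 h) (cong (λ s′ → g s + sumFrom g s′ h) (+-comm s 1))

sumFrom-≤ : ∀ g {a h m} → a + h ≤ m → sumFrom g a h ≤ sumFrom g 0 m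
sumFrom-≤ g {a} {h} a+h≤m with m≤n⇒∃[o]m+o≡n a+h≤m
... | k , refl = begin
  sumFrom g a h                              ≤⟨ m≤n+m _ _ ⟩
  sumFrom g 0 a + sumFrom g a h              ≡⟨ sumFrom-+ g 0 a h ⟨
  sumFrom g 0 (a + h)                        ≤⟨ m≤m+n _ _ ⟩
  sumFrom g 0 (a + h) + sumFrom g (a + h) k  ≡⟨ sumFrom-+ g 0 (a + h) k ⟨
  sumFrom g 0 (a + h + k)                    ∎

Σ-Fin-sumFrom : ∀ g s h → Σ-Fin h (λ i → g (s + toℕ i)) ≡ sumFrom g s h
Σ-Fin-sumFrom g s zero    = refl
Σ-Fin-sumFrom g s (suc h) = begin-equality
  Σ-Fin (suc h) (λ i → g (s + toℕ i))                    ≡⟨ Σ-Fin-suc {h} (λ i → g (s + toℕ i)) ⟩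
  g (s + 0) + Σ-Fin h (λ i → g (s + suc (toℕ i)))        ≡⟨ cong₂ _+_ (cong g (+-identityʳ s)) shifted ⟩
  g s + sumFrom g (suc s) h                              ≡⟨ sumFrom-suc g s h ⟨
  sumFrom g s (suc h)                                    ∎
  where
  shifted : Σ-Fin h (λ i → g (s + suc (toℕ i))) ≡ sumFrom g (suc s) h
  shifted = trans (Σ-Fin-cong {h} λ i → cong g (+-suc s (toℕ i))) (Σ-Fin-sumFrom g (suc s) h)

count : ∀ {w} → (Fin w → Bool) → ℕ
count {w} f = Σ-Fin w λ j → toN (f j)

toN≤1 : ∀ b → toN b ≤ 1
toN≤1 true  = s≤s z≤n
toN≤1 false = z≤n

-- The contribution of a row f, at row distance d, to the degree of a cell in column c;
-- `degree` is definitionally the sum of these over all rows.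
neighbours : ∀ {w} → ℕ → (Fin w → Bool) → Fin w → ℕ
neighbours {w} d f c = Σ-Fin w λ j → toN ((d + ∣ toℕ c - toℕ j ∣ ≡ᵇ 1) ∧ f j)

neighbours-cong : ∀ {w} d {f g : Fin w → Bool} c → f ≗ g → neighbours d f c ≡ neighbours d g c
neighbours-cong d c f≗g = Σ-Fin-cong λ j → cong (λ b → toN ((d + ∣ toℕ c - toℕ j ∣ ≡ᵇ 1) ∧ b)) (f≗g j)

neighbours-empty : ∀ {w} d {f : Fin w → Bool} c → (∀ j → f j ≡ false) → neighbours d f c ≡ 0
neighbours-empty d c empty =
  Σ-Fin-zero λ j → cong toN (trans (cong (_ ∧_) (empty j)) (∧-zeroʳ _))

neighbours-1 : ∀ {w} (f : Fin w → Bool) c → neighbours 1 f c ≡ toN (f c)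
neighbours-1 f c = trans (Σ-Fin-single _ c off) on-c
  where
  off : ∀ j → j ≢ c → toN ((∣ toℕ c - toℕ j ∣ ≡ᵇ 0) ∧ f j) ≡ 0
  off j j≢c with ∣ toℕ c - toℕ j ∣ in c-j
  ... | zero  = contradiction (toℕ-injective (sym (∣m-n∣≡0⇒m≡n c-j))) j≢c
  ... | suc _ = refl
  on-c : toN ((∣ toℕ c - toℕ c ∣ ≡ᵇ 0) ∧ f c) ≡ toN (f c)
  on-c rewrite ∣n-n∣≡0 (toℕ c) = refl

capacity : ∀ {w} → (Fin w → Bool) → ℕ
capacity {w} f = Σ-Fin w λ c → if f c then 2 ∸ neighbours 0 f c else 2

∣suc-n-n∣≡1 : ∀ n → ∣ suc n - n ∣ ≡ 1
∣suc-n-n∣≡1 zero    = refl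
∣suc-n-n∣≡1 (suc n) = ∣suc-n-n∣≡1 n

module _ {n w : ℕ} (W : Word n w) where

  -- The paper's 1-indexed row W[r], padded by empty rows W[0] and W[r] for r > n.
  row : ℕ → Fin w → Bool
  row zero    _ = false
  row (suc r) j with r <? n
  ... | yes r<n = W (fromℕ< r<n) j
  ... | no  _   = false

  rowCount : ℕ → ℕ
  rowCount r = count (row r)

  row-fromℕ< : ∀ {r} (r<n : r < n) j → row (suc r) j ≡ W (fromℕ< r<n) j
  row-fromℕ< {r} r<n j with r <? n
  ... | yes _   = refl
  ... | no  r≮n = contradiction r<n r≮n

  row-toℕ : ∀ i j → row (suc (toℕ i)) j ≡ W i j
  row-toℕ i j = trans (row-fromℕ< (toℕ<n i) j) (cong (λ i′ → W i′ j) (fromℕ<-toℕ i (toℕ<n i)))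

  row-beyond : ∀ {r} → n ≤ r → ∀ j → row (suc r) j ≡ false
  row-beyond {r} n≤r j with r <? n
  ... | yes r<n = contradiction n≤r (<⇒≱ r<n)
  ... | no  _   = refl

  filled≡sumFrom-rowCount : filled W ≡ sumFrom rowCount 1 n
  filled≡sumFrom-rowCount =
    trans (Σ-Fin-cong λ i → sym (Σ-Fin-cong λ j → cong toN (row-toℕ i j))) (Σ-Fin-sumFrom rowCount 1 n)

  filled-rowsFrom : ∀ s h (le : s + h ≤ n) → filled (rowsFrom W s h le) ≡ sumFrom rowCount (suc s) h
  filled-rowsFrom s h le =
    trans (Σ-Fin-cong λ i → sym (Σ-Fin-cong λ j → cong toN (row-in-block i j)))
          (Σ-Fin-sumFrom rowCount (suc s) h)
    where
    row-in-block : ∀ i j → row (suc (s + toℕ i)) j ≡ W (inject≤ (s ↑ʳ i) le) j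
    row-in-block i j =
      trans (cong (λ r → row (suc r) j) (sym (trans (toℕ-inject≤ (s ↑ʳ i) le) (toℕ-↑ʳ s i))))
            (row-toℕ (inject≤ (s ↑ʳ i) le) j)

  rowFilled≡rowCount : ∀ {r} → r < n → rowFilled W (suc r) ≡ rowCount (suc r)
  rowFilled≡rowCount {r} r<n = trans (Σ-Fin-single _ (fromℕ< r<n) off) on-r
    where
    off : ∀ i → i ≢ fromℕ< r<n → (if toℕ i ≡ᵇ r then count (W i) else 0) ≡ 0
    off i i≢r with toℕ i ≡ᵇ r in i≡ᵇr
    ... | false = refl
    ... | true  = contradiction (toℕ-injective (trans (≡ᵇ⇒≡ _ _ (subst T (sym i≡ᵇr) _))
                                                      (sym (toℕ-fromℕ< r<n)))) i≢r
    on-r : (if toℕ (fromℕ< r<n) ≡ᵇ r then count (W (fromℕ< r<n)) else 0) ≡ rowCount (suc r)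
    on-r rewrite toℕ-fromℕ< r<n | Equivalence.to T-≡ (≡⇒≡ᵇ r r refl) =
      Σ-Fin-cong λ j → cong toN (sym (row-fromℕ< r<n j))

  module _ (W∈𝒲² : InW2 W) {r : ℕ} (r<n : r < n) where

    private
      around : Fin w → ℕ → ℕ
      around c ρ = neighbours ∣ suc r - ρ ∣ (row ρ) c

      degree≡sumFrom : ∀ c → degree W (fromℕ< r<n) c ≡ sumFrom (around c) 0 (2 + n)
      degree≡sumFrom c = begin-equality
        degree W (fromℕ< r<n) c                    ≡⟨ Σ-Fin-cong row-term ⟩
        Σ-Fin n (λ i → around c (1 + toℕ i))       ≡⟨ Σ-Fin-sumFrom (around c) 1 n ⟩
        sumFrom (around c) 1 n                     ≡⟨ +-identityʳ _ ⟨
        0 + sumFrom (around c) 1 n + 0             ≡⟨ cong₂ _+_ (cong (_+ sumFrom (around c) 1 n) (sym top))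
                                                                bottom ⟩
        around c 0 + sumFrom (around c) 1 n + around c (suc n + 0)
                                                   ≡⟨ cong (_+ around c (suc n + 0)) (sumFrom-suc (around c) 0 n) ⟨
        sumFrom (around c) 0 (2 + n)               ∎
        where
        row-term : ∀ i → neighbours ∣ toℕ (fromℕ< r<n) - toℕ i ∣ (W i) c ≡ around c (1 + toℕ i)
        row-term i = trans (cong (λ x → neighbours ∣ x - toℕ i ∣ (W i) c) (toℕ-fromℕ< r<n))
                           (neighbours-cong ∣ r - toℕ i ∣ c (sym ∘ row-toℕ i))
        top : around c 0 ≡ 0
        top = neighbours-empty (suc r) c λ _ → refl
        bottom : 0 ≡ around c (suc n + 0)
        bottom = sym (neighbours-empty ∣ r - n + 0 ∣ c (row-beyond (m≤m+n n 0)))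

    vertical+horizontal≤2 : ∀ c → row (suc r) c ≡ true →
      toN (row r c) + neighbours 0 (row (suc r)) c + toN (row (2 + r) c) ≤ 2
    vertical+horizontal≤2 c filled-c = begin
      toN (row r c) + neighbours 0 (row (suc r)) c + toN (row (2 + r) c)  ≡⟨ three-rows ⟩
      sumFrom (around c) r 3                                              ≤⟨ sumFrom-≤ (around c) r+3≤2+n ⟩
      sumFrom (around c) 0 (2 + n)                                        ≡⟨ degree≡sumFrom c ⟨
      degree W (fromℕ< r<n) c                   ≤⟨ W∈𝒲² _ c (trans (sym (row-fromℕ< r<n c)) filled-c) ⟩
      2                                                                   ∎
      where
      r+3≤2+n : r + 3 ≤ 2 + n
      r+3≤2+n = subst (_≤ 2 + n) (+-comm 3 r) (s≤s (s≤s r<n))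
      three-rows : toN (row r c) + neighbours 0 (row (suc r)) c + toN (row (2 + r) c)
                   ≡ sumFrom (around c) r 3
      three-rows = sym (cong₂ _+_
        (cong₂ _+_ (trans (cong (λ d → neighbours d (row r) c) (∣suc-n-n∣≡1 r)) (neighbours-1 (row r) c))
                   (cong (λ d → neighbours d (row (suc r)) c) (∣n-n∣≡0 r)))
        (trans (cong (λ d → neighbours d (row (2 + r)) c) (trans (∣-∣-comm r (suc r)) (∣suc-n-n∣≡1 r)))
               (neighbours-1 (row (2 + r)) c)))

    neighbourRows≤capacity : rowCount r + rowCount (2 + r) ≤ capacity (row (suc r))
    neighbourRows≤capacity = begin
      rowCount r + rowCount (2 + r)                            ≡⟨ Σ-Fin-+ (toN ∘ row r) (toN ∘ row (2 + r)) ⟩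
      Σ-Fin w (λ c → toN (row r c) + toN (row (2 + r) c))     ≤⟨ Σ-Fin-mono column ⟩
      capacity (row (suc r))                                   ∎
      where
      column : ∀ c → toN (row r c) + toN (row (2 + r) c)
                     ≤ (if row (suc r) c then 2 ∸ neighbours 0 (row (suc r)) c else 2)
      column c with row (suc r) c in filled-c
      ... | true  = m+n≤o⇒m≤o∸n _ (≤-trans (≤-reflexive (xy∙z≈xz∙y
                                                            (toN (row r c)) (toN (row (2 + r) c)) _))
                                            (vertical+horizontal≤2 c filled-c))
      ... | false = +-mono-≤ (toN≤1 (row r c)) (toN≤1 (row (2 + r) c))

allVecs : ∀ {n} → (Vec Bool n → Bool) → Bool
allVecs {zero}  P = P []
allVecs {suc n} P = allVecs (P ∘ (false ∷_)) ∧ allVecs (P ∘ (true ∷_))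

allVecs-sound : ∀ {n} (P : Vec Bool n → Bool) → T (allVecs P) → ∀ v → T (P v)
allVecs-sound P holds []          = holds
allVecs-sound P holds (false ∷ v) = allVecs-sound _ (proj₁ (Equivalence.to T-∧ holds)) v
allVecs-sound P holds (true ∷ v)  = allVecs-sound _ (proj₂ (Equivalence.to T-∧ holds)) v

-- Only the entries for 5 and 6 filled cells are sharp; 12 = 2 · 6 is the trivial bound.
maxCapacity : ℕ → ℕ
maxCapacity 5 = 6
maxCapacity 6 = 2
maxCapacity _ = 12

-- An exhaustive check; `lookup (tabulate f)` is not `f`, but both agree on the six columns,
-- which is all that `capacity` and `count` inspect once unfolded.
capacity≤maxCapacity : (f : Fin 6 → Bool) → capacity f ≤ maxCapacity (count f)
capacity≤maxCapacity f =
  ≤ᵇ⇒≤ _ _ (allVecs-sound (λ v → capacity (lookup v) ≤ᵇ maxCapacity (count (lookup v))) _ (tabulate f))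

count≤6 : (f : Fin 6 → Bool) → count f ≤ 6
count≤6 f = Σ-Fin-mono (toN≤1 ∘ f)

toℚᵘ-excess : ∀ {a b} (V : Word a b) →
  toℚᵘ (excess V) ℚᵘ.≃ mkℚᵘ (+ filled V) 0 ℚᵘ.+ ℚᵘ.- mkℚᵘ (+ (2 * a * b)) 2
toℚᵘ-excess {a} {b} V = ℚᵘᴾ.≃-trans (ℚᴾ.toℚᵘ-homo-+ ((+ F) / 1) (-ℚ ((+ X) / 3)))
  (ℚᵘᴾ.+-cong (ℚᴾ.toℚᵘ-fromℚᵘ (mkℚᵘ (+ F) 0))
              (ℚᵘᴾ.≃-trans (ℚᴾ.toℚᵘ-homo‿- ((+ X) / 3)) (ℚᵘᴾ.-‿cong (ℚᴾ.toℚᵘ-fromℚᵘ (mkℚᵘ (+ X) 2)))))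
  where
  F = filled V
  X = 2 * a * b

private
  -- numerator of F/1 - X/3 in ℚᵘ, times the denominator 1 of c/1, plus X
  cleared : ∀ F X → (+ F ℤ.* + 3 ℤ.+ ℤ.- + X ℤ.* + 1) ℤ.* + 1 ℤ.+ + X ≡ + (F * 3)
  cleared F X = trans (identity (+ F) (+ X)) (sym (ℤᴾ.pos-* F 3))
    where
    identity : ∀ x y → (x ℤ.* + 3 ℤ.+ ℤ.- y ℤ.* + 1) ℤ.* + 1 ℤ.+ y ≡ x ℤ.* + 3
    identity = ℤ-Solver.solve-∀

  pos-*3+ : ∀ c X → + c ℤ.* + 3 ℤ.+ + X ≡ + (c * 3 + X)
  pos-*3+ c X = sym (trans (ℤᴾ.pos-+ (c * 3) X) (cong (ℤ._+ + X) (ℤᴾ.pos-* c 3)))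

excess≤⇒ : ∀ {a b} (V : Word a b) c → excess V ≤ℚ (+ c) / 1 → filled V * 3 ≤ c * 3 + 2 * a * b
excess≤⇒ {a} {b} V c le
  with ℚᵘᴾ.≤-respʳ-≃ (ℚᴾ.toℚᵘ-fromℚᵘ (mkℚᵘ (+ c) 0)) (ℚᵘᴾ.≤-respˡ-≃ (toℚᵘ-excess V) (ℚᴾ.toℚᵘ-mono-≤ le))
... | *≤* ineq = ℤᴾ.drop‿+≤+ (subst₂ ℤ._≤_ (cleared (filled V) (2 * a * b)) (pos-*3+ c (2 * a * b))
                                            (ℤᴾ.+-monoˡ-≤ (+ (2 * a * b)) ineq))

excess≥⇒ : ∀ {a b} (V : Word a b) c → (+ c) / 1 ≤ℚ excess V → c * 3 + 2 * a * b ≤ filled V * 3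
excess≥⇒ {a} {b} V c le
  with ℚᵘᴾ.≤-respˡ-≃ (ℚᴾ.toℚᵘ-fromℚᵘ (mkℚᵘ (+ c) 0)) (ℚᵘᴾ.≤-respʳ-≃ (toℚᵘ-excess V) (ℚᴾ.toℚᵘ-mono-≤ le))
... | *≤* ineq = ℤᴾ.drop‿+≤+ (subst₂ ℤ._≤_ (pos-*3+ c (2 * a * b)) (cleared (filled V) (2 * a * b))
                                            (ℤᴾ.+-monoˡ-≤ (+ (2 * a * b)) ineq))

private
  by-thirds : ∀ h c → c * 3 + 2 * h * 6 ≡ (4 * h + c) * 3
  by-thirds = solve-∀

filled≤ : ∀ {h} (V : Word h 6) c → excess V ≤ℚ (+ c) / 1 → filled V ≤ 4 * h + c
filled≤ {h} V c le = *-cancelʳ-≤ _ _ 3 (≤-trans (excess≤⇒ V c le) (≤-reflexive (by-thirds h c)))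

filled≡ : ∀ {h} (V : Word h 6) c → excess V ≡ (+ c) / 1 → filled V ≡ 4 * h + c
filled≡ {h} V c e = ≤-antisym (filled≤ V c (ℚᴾ.≤-reflexive e))
  (*-cancelʳ-≤ _ _ 3
    (≤-trans (≤-reflexive (sym (by-thirds h c))) (excess≥⇒ V c (ℚᴾ.≤-reflexive (sym e)))))

emax-3+h : ∀ h → 2 ≤ h → emax (3 + h) 6 ≡ emax h 6
emax-3+h 1 (s≤s ())
emax-3+h 2 _ = refl
emax-3+h 3 _ = refl
emax-3+h 4 _ = refl
emax-3+h 5 _ = refl
-- for h ≥ 6 both sides are emaxGE _ 6, and (3 + h) % 3 computes to h % 3 even for symbolic h
emax-3+h (suc (suc (suc (suc (suc (suc m)))))) _ = refl

emax-periodic : ∀ h q → 2 ≤ h → emax (h + 3 * q) 6 ≡ emax h 6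
emax-periodic h zero    _   = cong (λ x → emax x 6) (+-identityʳ h)
emax-periodic h (suc q) 2≤h =
  trans (cong (λ x → emax x 6) (shift h q))
        (trans (emax-periodic (3 + h) q (≤-trans 2≤h (m≤n+m h 3))) (emax-3+h h 2≤h))
  where
  shift : ∀ h q → h + 3 * suc q ≡ 3 + h + 3 * q
  shift = solve-∀

module TopRows (t : ℕ) (W : Word (3 * (2 + t)) 6) (W∈𝒲² : InW2 W) (excess≡2 : excess W ≡ (+ 2) / 1)
  (blocks : (h' s : ℕ) (le : s + h' ≤ 3 * (2 + t)) → 1 ≤ h' → h' < 3 * (2 + t)
            → excess (rowsFrom W s h' le) ≤ℚ emax h' 6) where

  N : ℕ
  N = 3 * (2 + t)

  R : ℕ → ℕ
  R = rowCount W

  6+3t≡N : 6 + 3 * t ≡ N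
  6+3t≡N = sym (*-distribˡ-+ 3 2 t)

  ≤5⇒<N : ∀ {h} → h ≤ 5 → h < N
  ≤5⇒<N {h} h≤5 = subst (h <_) 6+3t≡N (≤-trans (s≤s h≤5) (m≤m+n 6 (3 * t)))

  total : sumFrom R 1 N ≡ 4 * N + 2
  total = trans (sym (filled≡sumFrom-rowCount W)) (filled≡ W 2 excess≡2)

  block≤ : ∀ s h c (le : s + h ≤ N) → 1 ≤ h → h < N → emax h 6 ≡ (+ c) / 1 →
           sumFrom R (suc s) h ≤ 4 * h + c
  block≤ s h c le 1≤h h<N emax≡c = subst (_≤ 4 * h + c) (filled-rowsFrom W s h le)
    (filled≤ (rowsFrom W s h le) c (subst (excess (rowsFrom W s h le) ≤ℚ_) emax≡c (blocks h s le 1≤h h<N)))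

  top-block≤ : ∀ s h c → s + h ≤ 5 → 1 ≤ h → emax h 6 ≡ (+ c) / 1 → sumFrom R (suc s) h ≤ 4 * h + c
  top-block≤ s h c s+h≤5 1≤h = block≤ s h c (<⇒≤ (≤5⇒<N s+h≤5)) 1≤h (≤5⇒<N (m+n≤o⇒n≤o s s+h≤5))

  prefix≥ : ∀ j m c → 1 ≤ j → 1 ≤ m → j + m ≡ N → emax m 6 ≡ (+ c) / 1 → 4 * j + 2 ∸ c ≤ sumFrom R 1 j
  prefix≥ j m c 1≤j 1≤m j+m≡N emax≡c = m≤n+o⇒m∸n≤o (4 * j + 2) c (+-cancelʳ-≤ (4 * m) _ _ (begin
    4 * j + 2 + 4 * m                    ≡⟨ regroup j m ⟩
    4 * (j + m) + 2                      ≡⟨ cong (λ x → 4 * x + 2) j+m≡N ⟩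
    4 * N + 2                            ≡⟨ total ⟨
    sumFrom R 1 N                        ≡⟨ cong (sumFrom R 1) j+m≡N ⟨
    sumFrom R 1 (j + m)                  ≡⟨ sumFrom-+ R 1 j m ⟩
    sumFrom R 1 j + sumFrom R (suc j) m  ≤⟨ +-monoʳ-≤ (sumFrom R 1 j) complement≤ ⟩
    sumFrom R 1 j + (4 * m + c)          ≡⟨ reorder (sumFrom R 1 j) m c ⟩
    c + sumFrom R 1 j + 4 * m            ∎))
    where
    complement≤ : sumFrom R (suc j) m ≤ 4 * m + c
    complement≤ = block≤ j m c (≤-reflexive j+m≡N) 1≤m (subst (m <_) j+m≡N (m<n+m m 1≤j)) emax≡c
    regroup : ∀ j m → 4 * j + 2 + 4 * m ≡ 4 * (j + m) + 2
    regroup = solve-∀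
    reorder : ∀ P m c → P + (4 * m + c) ≡ c + P + 4 * m
    reorder = solve-∀

  neighbourRows : ∀ {ρ k} → ρ < N → R (suc ρ) ≡ k → R ρ + R (2 + ρ) ≤ maxCapacity k
  neighbourRows {ρ} ρ<N refl =
    ≤-trans (neighbourRows≤capacity W W∈𝒲² ρ<N) (capacity≤maxCapacity (row W (suc ρ)))

  R1+R2≡9 : R 1 + R 2 ≡ 9
  R1+R2≡9 = ≤-antisym (top-block≤ 0 2 1 (s≤s (s≤s z≤n)) z<s refl)
                      (prefix≥ 2 (4 + 3 * t) 1 z<s z<s 6+3t≡N (emax-periodic 4 t (s≤s (s≤s z≤n))))

  R1≢6 : R 1 ≢ 6
  R1≢6 R1≡6 = n≮n 8 (begin
    9          ≡⟨ R1+R2≡9 ⟨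
    R 1 + R 2  ≤⟨ +-mono-≤ (≤-reflexive R1≡6) (neighbourRows (≤5⇒<N z≤n) R1≡6) ⟩
    8          ∎)

  R1≡5 : R 1 ≡ 5
  R1≡5 = ≤-antisym (≤-pred (≤∧≢⇒< (count≤6 (row W 1)) R1≢6))
                   (prefix≥ 1 (5 + 3 * t) 1 z<s z<s 6+3t≡N (emax-periodic 5 t (s≤s (s≤s z≤n))))

  R2≡4 : R 2 ≡ 4
  R2≡4 = +-cancelˡ-≡ 5 _ _ (trans (cong (_+ R 2) (sym R1≡5)) R1+R2≡9)

  R1+⋯+R4≡17 : sumFrom R 1 4 ≡ 17
  R1+⋯+R4≡17 = ≤-antisym (top-block≤ 0 4 1 (s≤s (s≤s (s≤s (s≤s z≤n)))) z<s refl)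
                         (prefix≥ 4 (2 + 3 * t) 1 z<s z<s 6+3t≡N (emax-periodic 2 t ≤-refl))

  R3+R4≡8 : R 3 + R 4 ≡ 8
  R3+R4≡8 = +-cancelˡ-≡ 9 _ _ (trans (cong (λ x → x + R 3 + R 4) (sym R1+R2≡9)) R1+⋯+R4≡17)

  3≤R3 : 3 ≤ R 3
  3≤R3 = +-cancelˡ-≤ 9 3 (R 3) (subst (λ x → 12 ≤ x + R 3) R1+R2≡9
           (prefix≥ 3 (3 + 3 * t) 2 z<s z<s 6+3t≡N (emax-periodic 3 t (s≤s (s≤s z≤n)))))

  R3≤5 : R 3 ≤ 5
  R3≤5 = +-cancelˡ-≤ 4 (R 3) 5 (subst (λ x → x + R 3 ≤ 9) R2≡4
           (top-block≤ 1 2 1 (s≤s (s≤s (s≤s z≤n))) z<s refl))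

  R3≢5 : R 3 ≢ 5
  R3≢5 R3≡5 = n≮n 6 (begin
    7          ≡⟨ cong₂ _+_ R2≡4 R4≡3 ⟨
    R 2 + R 4  ≤⟨ neighbourRows (≤5⇒<N (s≤s (s≤s z≤n))) R3≡5 ⟩
    6          ∎)
    where
    R4≡3 : R 4 ≡ 3
    R4≡3 = +-cancelˡ-≡ 5 _ _ (trans (cong (_+ R 4) (sym R3≡5)) R3+R4≡8)

  R3≢3 : R 3 ≢ 3
  R3≢3 R3≡3 = by-height t refl
    where
    R4≡5 : R 4 ≡ 5
    R4≡5 = +-cancelˡ-≡ 3 _ _ (trans (cong (_+ R 4) (sym R3≡3)) R3+R4≡8)
    R5≤3 : R 5 ≤ 3
    R5≤3 = +-cancelˡ-≤ 3 (R 5) 3 (subst (λ x → x + R 5 ≤ 6) R3≡3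
             (neighbourRows (≤5⇒<N (s≤s (s≤s (s≤s z≤n)))) R4≡5))
    R1+⋯+R5≡17+R5 : sumFrom R 1 5 ≡ 17 + R 5
    R1+⋯+R5≡17+R5 = cong (_+ R 5) R1+⋯+R4≡17
    -- a split on the module parameter t has to go through an equation
    by-height : ∀ t′ → t ≡ t′ → ⊥
    by-height zero refl = n≮n 2 (≤-trans 3≤R5 R5≤2)
      where
      3≤R5 : 3 ≤ R 5
      3≤R5 = +-cancelˡ-≤ 17 3 (R 5) (subst (20 ≤_) R1+⋯+R5≡17+R5 (prefix≥ 5 1 2 z<s z<s refl refl))
      R6≡6 : R 6 ≡ 6
      R6≡6 = +-cancelˡ-≡ 20 _ _ (begin-equality
        20 + R 6             ≡⟨ cong (λ x → 17 + x + R 6) (≤-antisym R5≤3 3≤R5) ⟨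
        17 + R 5 + R 6       ≡⟨ cong (_+ R 6) R1+⋯+R5≡17+R5 ⟨
        sumFrom R 1 6        ≡⟨ total ⟩
        26                   ∎)
      R5≤2 : R 5 ≤ 2
      R5≤2 = m+n≤o⇒m≤o (R 5) (neighbourRows (≤5⇒<N ≤-refl) R6≡6)
    by-height (suc t′) refl = n≮n 3 (≤-trans 4≤R5 R5≤3)
      where
      emax≡1 : emax (1 + 3 * suc t′) 6 ≡ (+ 1) / 1
      emax≡1 = trans (cong (λ x → emax (suc x) 6) (*-suc 3 t′)) (emax-periodic 4 t′ (s≤s (s≤s z≤n)))
      4≤R5 : 4 ≤ R 5
      4≤R5 = +-cancelˡ-≤ 17 4 (R 5) (subst (21 ≤_) R1+⋯+R5≡17+R5
               (prefix≥ 5 (1 + 3 * suc t′) 1 z<s z<s 6+3t≡N emax≡1))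

  R3≡4 : R 3 ≡ 4
  R3≡4 = ≤-antisym (≤-pred (≤∧≢⇒< R3≤5 R3≢5)) (≤∧≢⇒< 3≤R3 (R3≢3 ∘ sym))

  first-rows : rowFilled W 1 ≡ 5 × rowFilled W 2 ≡ 4 × rowFilled W 3 ≡ 4
  first-rows = trans (rowFilled≡rowCount W (≤5⇒<N z≤n)) R1≡5
             , trans (rowFilled≡rowCount W (≤5⇒<N (s≤s z≤n))) R2≡4
             , trans (rowFilled≡rowCount W (≤5⇒<N (s≤s (s≤s z≤n)))) R3≡4

proposition6 : (k : ℕ) → 2 ≤ k → (W : Word (3 * k) 6) → InW2 W
    → excess W ≡ (+ 2) / 1
    → ((h' s : ℕ) (le : s + h' ≤ 3 * k) → 1 ≤ h' → h' < 3 * k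
        → excess (rowsFrom W s h' le) ≤ℚ emax h' 6)
    → rowFilled W 1 ≡ 5 × rowFilled W 2 ≡ 4 × rowFilled W 3 ≡ 4
proposition6 (suc (suc t)) _         = TopRows.first-rows t
proposition6 (suc zero)    (s≤s ())
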